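{- Let $NC$ be an initial neuronal circuit, $L=|ln_{NC}|+si_{NC}$, and $\mathit{inp}=[f_1;\dots;f_k]$ a list of external input functions. (1) If $N_1,N_2\in ln_{NC}$, $\mathit{One\_input}(N_1,id_{N_2},L)$ and $\tau_{N_1}\le w_{N_1}(id_{N_2})$, then $output_{NC}(N_1,\mathit{inp})=\mathit{tl}(output_{NC}(N_2,\mathit{inp}))\mathbin{++}[0]$. (2) If $N\in ln_{NC}$, $m\in\mathbb{N}$ with $|ln_{NC}|\le m<L$, $\mathit{One\_input}(N,m,L)$ and $\tau_N\le w_N(m)$, then $output_{NC}(N,\mathit{inp})=[f_1(m);\dots;f_k(m)]\mathbin{++}[0]$.
   Context: Booleans are identified with $0$ (false) and $1$ (true). A neuron $N$ consists of an identifier $id_N\in\mathbb{N}$, a weight function $w_N:\mathbb{N}\to\mathbb{Q}$ with $-1\le w_N(x)\le 1$ for all $x$ and $w_N(id_N)=0$, a leak factor $lk_N\in\mathbb{Q}$ with $0\le lk_N\le 1$, a threshold $\tau_N\in\mathbb{Q}$ with $\tau_N>0$, an output list $Output(N)$ of booleans (most recent first) and a current potential $CurPot(N)\in\mathbb{Q}$, subject to: $(\tau_N\le CurPot(N))$ equals the head of $Output(N)$ (the head of an empty list being $0$). An input function is a map $i:\mathbb{N}\to\{0,1\}$; $potential(w,i,len)=\sum_{0\le k<len,\ i(k)=1} w(k)$. The one-step update of $N$ with input function $i$ in an environment of $len$ neurons keeps $id,w,lk,\tau$, sets the new potential $p=potential(w_N,i,len)$ if $\tau_N\le CurPot(N)$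 and $p=potential(w_N,i,len)+lk_N\cdot CurPot(N)$ otherwise, and sets the new output list to $(\tau_N\le p)::Output(N)$. A neuron is initial if its output list is $[0]$ and its current potential is $0$. $\mathit{One\_input}(N,id,len)$ means $id<len$ and $w_N(id')=0$ for all $id'\neq id$ with $id'<len$. A neuronal circuit $NC$ consists of a time $t_{NC}$, a list $ln_{NC}$ of neurons with pairwise distinct identifiers all $<|ln_{NC}|$ and all output lists of length $t_{NC}+1$, and a number $si_{NC}$ of external sources, with identifiers $|ln_{NC}|,\dots,L-1$, $L=|ln_{NC}|+si_{NC}$. One step of $NC$ on an external input function $e$ replaces each neuron $N$ by its one-step update in an environment of $L$ neurons with input function $x\mapsto$ (head of the output list, before the step, of the circuit neuron with identifier $x$ if $x<|ln_{NC}|$; $e(x)$ otherwise), and increments the time. A list of external input functions (most recent first) is processed from its last element to its first. For $N\in ln_{NC}$, $output_{NC}(N,\mathit{inp})$ is the output list of the neuron with identifier $id_N$ after processing $\mathit{inp}$. $NC$ is initial if all its neurons are initial. $\mathit{tl}(l)$ is $l$ without its first element (empty if $l$ is empty); $\mathbin{++}$ is concatenation. -}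

module Defs where

open import Data.Bool using (Bool; true; false; if_then_else_)
open import Data.Nat as ℕ using (ℕ; zero; suc; _<ᵇ_; _≡ᵇ_)
open import Data.Rational using (ℚ; 0ℚ; 1ℚ; -_; _+_; _*_; _≤_; _<_; _≤ᵇ_)
open import Data.List using (List; []; _∷_; map; length)
open import Data.List.Properties using (map-∘; length-map)
open import Data.List.Relation.Unary.All as All using (All; []; _∷_)
open import Data.List.Relation.Unary.Unique.Propositional using (Unique)
open import Data.Product using (_×_)
open import Relation.Binary.PropositionalEquality using (_≡_; _≢_; refl; subst; cong; sym)

headB : List Bool → Bool
headB []      = false
headB (b ∷ _) = b

tl : {A : Set} → List A → List A
tl []       = []
tl (_ ∷ xs) = xs

potential : (ℕ → ℚ) → (ℕ → Bool) → ℕ → ℚ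
potential w i zero    = 0ℚ
potential w i (suc n) = potential w i n + (if i n then w n else 0ℚ)

record Neuron : Set where
  field
    id      : ℕ
    w       : ℕ → ℚ
    lk      : ℚ
    τ       : ℚ
    Output  : List Bool
    CurPot  : ℚ
    w-low   : ∀ x → - 1ℚ ≤ w x
    w-high  : ∀ x → w x ≤ 1ℚ
    w-self  : w id ≡ 0ℚ
    lk-low  : 0ℚ ≤ lk
    lk-high : lk ≤ 1ℚ
    τ-pos   : 0ℚ < τ
    consistent : (τ ≤ᵇ CurPot) ≡ headB Output
open Neuron public

nextPot : Neuron → (ℕ → Bool) → ℕ → ℚ
nextPot N i len =
  if τ N ≤ᵇ CurPot N
  then potential (w N) i len
  else potential (w N) i len + lk N * CurPot N

NextNeuron : Neuron → (ℕ → Bool) → ℕ → Neuron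
NextNeuron N i len = record
  { id = id N ; w = w N ; lk = lk N ; τ = τ N
  ; Output = (τ N ≤ᵇ nextPot N i len) ∷ Output N
  ; CurPot = nextPot N i len
  ; w-low = w-low N ; w-high = w-high N ; w-self = w-self N
  ; lk-low = lk-low N ; lk-high = lk-high N ; τ-pos = τ-pos N
  ; consistent = refl }

Initial : Neuron → Set
Initial N = (Output N ≡ false ∷ []) × (CurPot N ≡ 0ℚ)

One-input : Neuron → ℕ → ℕ → Set
One-input N i len = (i ℕ.< len) × (∀ i' → i' ≢ i → i' ℕ.< len → w N i' ≡ 0ℚ)

record Circuit : Set where
  field
    Time  : ℕ
    ln    : List Neuron
    si    : ℕ
    ids-distinct : Unique (map id ln)
    ids-bound    : All (λ N → id N ℕ.< length ln) ln
    out-length   : All (λ N → length (Output N) ≡ suc Time) ln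
open Circuit public

Lsize : Circuit → ℕ
Lsize NC = length (ln NC) ℕ.+ si NC

outputOfId : List Neuron → ℕ → List Bool
outputOfId []       x = []
outputOfId (N ∷ ns) x = if id N ≡ᵇ x then Output N else outputOfId ns x

circuitInput : List Neuron → (ℕ → Bool) → ℕ → Bool
circuitInput ns e x = if x <ᵇ length ns then headB (outputOfId ns x) else e x

stepList : List Neuron → (ℕ → Bool) → ℕ → List Neuron
stepList ns e L = map (λ N → NextNeuron N (circuitInput ns e) L) ns

private
  ids-step : ∀ ns e L → map id (stepList ns e L) ≡ map id ns
  ids-step [] e L = refl
  ids-step (N ∷ ns) e L = cong (id N ∷_) (ids-step' ns)
    where
    ids-step' : ∀ ms → map id (map (λ M → NextNeuron M (circuitInput (N ∷ ns) e) L) ms) ≡ map id ms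
    ids-step' [] = refl
    ids-step' (M ∷ ms) = cong (id M ∷_) (ids-step' ms)

  mapAll : ∀ {P Q : Neuron → Set} (f : Neuron → Neuron) → (∀ {N} → P N → Q (f N)) →
           ∀ {ns} → All P ns → All Q (map f ns)
  mapAll f g [] = []
  mapAll f g (p ∷ ps) = g p ∷ mapAll f g ps

NextCircuit : Circuit → (ℕ → Bool) → Circuit
NextCircuit NC e = record
  { Time = suc (Time NC)
  ; ln = stepList (ln NC) e (Lsize NC)
  ; si = si NC
  ; ids-distinct = subst Unique (sym (ids-step (ln NC) e (Lsize NC))) (ids-distinct NC)
  ; ids-bound = subst (λ n → All (λ N → id N ℕ.< n) (stepList (ln NC) e (Lsize NC)))
                      (sym (length-map _ (ln NC)))
                      (mapAll _ (λ p → p) (ids-bound NC))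
  ; out-length = mapAll _ (λ p → cong suc p) (out-length NC) }

-- process a list of external inputs (most recent first): last element first
process : Circuit → List (ℕ → Bool) → Circuit
process NC []       = NC
process NC (f ∷ fs) = NextCircuit (process NC fs) f

output : Circuit → Neuron → List (ℕ → Bool) → List Bool
output NC N inp = outputOfId (ln (process NC inp)) (id N)

InitialCircuit : Circuit → Set
InitialCircuit NC = All Initial (ln NC)

{-# OPTIONS --safe #-}
-- A neuron with a single input j whose weight reaches the threshold acts as a
-- relay: as long as it carries no potential from one step to the next, its new
-- potential is exactly the weight of j if j fired and 0 otherwise, so it fires
-- precisely when j did, and this again leaves no potential to carry over.
-- Starting from an initial neuron, its output list is therefore the list of
-- signals received from j, followed by the initial 0. When j is an external
-- source these signals are the inputs f(j); when j is a circuit neuron they are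
-- the successive heads of its output list, i.e. that output list without its
-- most recent entry.
module Submission where

open import Defs
open import Data.Bool using (Bool; true; false; T; if_then_else_)
open import Data.Bool.Properties using (T-≡)
open import Data.Nat as ℕ using (ℕ; zero; suc; s≤s; _≤_; _<_; _<ᵇ_; _≡ᵇ_)
open import Data.Nat.Properties
  using (≤-refl; <⇒≢; <⇒≱; >⇒≢; m<n⇒m<1+n; m≤n⇒m<n∨m≡n; <ᵇ-reflects-<; ≡ᵇ⇒≡; ≡⇒≡ᵇ)
open import Data.List using (List; []; _∷_; _++_; map; length)
open import Data.List.Properties using (length-map)
open import Data.List.Membership.Propositional using (_∈_)
open import Data.List.Membership.Propositional.Properties using (∈-map⁺)
open import Data.List.Relation.Unary.All as All using (All)
open import Data.List.Relation.Unary.Any using (here; there)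
open import Data.List.Relation.Unary.AllPairs using (_∷_)
open import Data.List.Relation.Unary.Unique.Propositional using (Unique)
open import Data.Product using (_×_; _,_; proj₂)
open import Data.Sum using (_⊎_; inj₁; inj₂)
open import Data.Rational using (ℚ; 0ℚ; _+_; _*_; _≤ᵇ_)
open import Data.Rational.Properties
  using (≤⇒≤ᵇ; ≤ᵇ⇒≤; <-irrefl; <-≤-trans; +-identityˡ; +-identityʳ; *-zeroʳ)
open import Function.Bundles using (Equivalence)
open import Relation.Nullary using (contradiction)
open import Relation.Nullary.Reflects using (ofʸ; ofⁿ)
open import Relation.Binary.PropositionalEquality
open ≡-Reasoning
import Data.Rational as Q

≤⇒≤ᵇ≡true : ∀ {p q} → p Q.≤ q → (p ≤ᵇ q) ≡ true
≤⇒≤ᵇ≡true p≤q = Equivalence.to T-≡ (≤⇒≤ᵇ p≤q)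

>⇒≤ᵇ≡false : ∀ {p q} → p Q.> q → (p ≤ᵇ q) ≡ false
>⇒≤ᵇ≡false {p} {q} p>q with p ≤ᵇ q in p≤ᵇq
... | false = refl
... | true  = contradiction (<-≤-trans p>q (≤ᵇ⇒≤ (subst T (sym p≤ᵇq) _))) (<-irrefl refl)

headB∷tl : ∀ {n} (bs : List Bool) → length bs ≡ suc n → headB bs ∷ tl bs ≡ bs
headB∷tl (_ ∷ _) _ = refl

contribution : (ℕ → ℚ) → (ℕ → Bool) → ℕ → ℚ
contribution w i k = if i k then w k else 0ℚ

contribution-of-zero : ∀ {w i k} → w k ≡ 0ℚ → contribution w i k ≡ 0ℚ
contribution-of-zero {i = i} {k} wk≡0 with i k
... | true  = wk≡0
... | false = refl

potential-vanishing : ∀ {w i} n → (∀ k → k < n → w k ≡ 0ℚ) → potential w i n ≡ 0ℚ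
potential-vanishing zero    _   = refl
potential-vanishing {w} {i} (suc n) w≡0 = begin
  potential w i n + contribution w i n
    ≡⟨ cong₂ _+_ (potential-vanishing n (λ k k<n → w≡0 k (m<n⇒m<1+n k<n)))
                 (contribution-of-zero {w} {i} (w≡0 n ≤-refl)) ⟩
  0ℚ + 0ℚ
    ≡⟨ +-identityʳ 0ℚ ⟩
  0ℚ ∎

potential-single : ∀ {w i j} n → j < n → (∀ k → k ≢ j → k < n → w k ≡ 0ℚ) →
                   potential w i n ≡ contribution w i j
potential-single {w} {i} {j} (suc n) (s≤s j≤n) w≡0 with m≤n⇒m<n∨m≡n j≤n
... | inj₂ refl = begin
  potential w i j + contribution w i j
    ≡⟨ cong (_+ contribution w i j)
            (potential-vanishing {w} {i} j (λ k k<j → w≡0 k (<⇒≢ k<j) (m<n⇒m<1+n k<j))) ⟩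
  0ℚ + contribution w i j
    ≡⟨ +-identityˡ _ ⟩
  contribution w i j ∎
... | inj₁ j<n = begin
  potential w i n + contribution w i n
    ≡⟨ cong₂ _+_ (potential-single n j<n (λ k k≢j k<n → w≡0 k k≢j (m<n⇒m<1+n k<n)))
                 (contribution-of-zero {w} {i} (w≡0 n (>⇒≢ j<n) ≤-refl)) ⟩
  contribution w i j + 0ℚ
    ≡⟨ +-identityʳ _ ⟩
  contribution w i j ∎

-- Either the neuron has just fired, so its potential is reset at the next step,
-- or its potential is 0: in both cases no leaked potential enters the next step.
Resting : Neuron → Set
Resting M = (τ M ≤ᵇ CurPot M) ≡ true ⊎ CurPot M ≡ 0ℚ

τ≤ᵇ0≡false : ∀ M → (τ M ≤ᵇ 0ℚ) ≡ false
τ≤ᵇ0≡false M = >⇒≤ᵇ≡false (τ-pos M)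

nextPot-resting : ∀ {M i L} → Resting M → nextPot M i L ≡ potential (w M) i L
nextPot-resting {M} (inj₁ fired) rewrite fired = refl
nextPot-resting {M} {i} {L} (inj₂ empty) rewrite empty | τ≤ᵇ0≡false M = begin
  potential (w M) i L + lk M * 0ℚ ≡⟨ cong (potential (w M) i L +_) (*-zeroʳ (lk M)) ⟩
  potential (w M) i L + 0ℚ        ≡⟨ +-identityʳ _ ⟩
  potential (w M) i L             ∎

record Relaying (j L : ℕ) (M : Neuron) : Set where
  field
    one-input      : One-input M j L
    fires-on-input : τ M Q.≤ w M j
    resting        : Resting M
open Relaying

relay-nextPot : ∀ {j L M i} → Relaying j L M → nextPot M i L ≡ contribution (w M) i j
relay-nextPot {L = L} {M} {i} r with one-input r
... | j<L , others-silent = begin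
  nextPot M i L          ≡⟨ nextPot-resting {M} {i} {L} (resting r) ⟩
  potential (w M) i L    ≡⟨ potential-single L j<L others-silent ⟩
  contribution (w M) i _ ∎

relay-fires : ∀ {j L M i} → Relaying j L M → (τ M ≤ᵇ nextPot M i L) ≡ i j
relay-fires {j} {M = M} {i} r rewrite relay-nextPot {i = i} r with i j
... | true  = ≤⇒≤ᵇ≡true (fires-on-input r)
... | false = τ≤ᵇ0≡false M

relay-next : ∀ {j L M i} → Relaying j L M → Relaying j L (NextNeuron M i L)
relay-next {j} {L} {M} {i} r = record
  { one-input      = one-input r
  ; fires-on-input = fires-on-input r
  ; resting        = resting′ }
  where
  resting′ : Resting (NextNeuron M i L)
  resting′ with i j in ij
  ... | true  = inj₁ (trans (relay-fires r) ij)
  ... | false = inj₂ (trans (relay-nextPot r) (cong (λ b → if b then w M j else 0ℚ) ij))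

outputOfId-∈ : ∀ {ns M} → Unique (map id ns) → M ∈ ns → outputOfId ns (id M) ≡ Output M
outputOfId-∈ {N ∷ ns} {M} (N∉ns ∷ unique) M∈ with id N ≡ᵇ id M in eq | M∈
... | true  | here refl  = refl
... | true  | there M∈ns =
  contradiction (≡ᵇ⇒≡ (id N) (id M) (subst T (sym eq) _)) (All.lookup N∉ns (∈-map⁺ id M∈ns))
... | false | here refl  = contradiction (subst T eq (≡⇒≡ᵇ (id N) (id N) refl)) λ ()
... | false | there M∈ns = outputOfId-∈ unique M∈ns

circuitInput-internal : ∀ ns e {x} → x < length ns → circuitInput ns e x ≡ headB (outputOfId ns x)
circuitInput-internal ns e {x} x<n with x <ᵇ length ns | <ᵇ-reflects-< x (length ns)
... | true  | _        = refl
... | false | ofⁿ x≮n = contradiction x<n x≮n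

circuitInput-external : ∀ ns e {x} → length ns ≤ x → circuitInput ns e x ≡ e x
circuitInput-external ns e {x} n≤x with x <ᵇ length ns | <ᵇ-reflects-< x (length ns)
... | true  | ofʸ x<n = contradiction n≤x (<⇒≱ x<n)
... | false | _       = refl

length-process : ∀ NC inp → length (ln (process NC inp)) ≡ length (ln NC)
length-process NC []       = refl
length-process NC (f ∷ fs) = trans (length-map _ (ln (process NC fs))) (length-process NC fs)

Lsize-next : ∀ C e → Lsize (NextCircuit C e) ≡ Lsize C
Lsize-next C e = cong (ℕ._+ si C) (length-map _ (ln C))

evolve : Circuit → List (ℕ → Bool) → Neuron → Neuron
evolve NC []       N = N
evolve NC (f ∷ fs) N =
  NextNeuron (evolve NC fs N) (circuitInput (ln (process NC fs)) f) (Lsize (process NC fs))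

evolve-id : ∀ {NC N} inp → id (evolve NC inp N) ≡ id N
evolve-id []       = refl
evolve-id (_ ∷ fs) = evolve-id fs

evolve-∈ : ∀ {NC N} → N ∈ ln NC → ∀ inp → evolve NC inp N ∈ ln (process NC inp)
evolve-∈ N∈ []       = N∈
evolve-∈ N∈ (_ ∷ fs) = ∈-map⁺ _ (evolve-∈ N∈ fs)

output-evolve : ∀ {NC N} → N ∈ ln NC → ∀ inp → output NC N inp ≡ Output (evolve NC inp N)
output-evolve {NC} {N} N∈ inp =
  subst (λ x → outputOfId (ln (process NC inp)) x ≡ Output (evolve NC inp N))
        (evolve-id inp)
        (outputOfId-∈ (ids-distinct (process NC inp)) (evolve-∈ N∈ inp))

received : Circuit → List (ℕ → Bool) → ℕ → List Bool
received NC []       x = []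
received NC (f ∷ fs) x = circuitInput (ln (process NC fs)) f x ∷ received NC fs x

evolve-relaying : ∀ {NC j N} → Relaying j (Lsize NC) N →
                  ∀ inp → Relaying j (Lsize (process NC inp)) (evolve NC inp N)
evolve-relaying r []       = r
evolve-relaying {NC} {j} {N} r (f ∷ fs) =
  subst (λ L → Relaying j L (evolve NC (f ∷ fs) N)) (sym (Lsize-next (process NC fs) f))
        (relay-next (evolve-relaying r fs))

relay-output : ∀ {NC j N} → Initial N → One-input N j (Lsize NC) → τ N Q.≤ w N j →
               ∀ inp → Output (evolve NC inp N) ≡ received NC inp j ++ false ∷ []
relay-output (output≡[0] , _) _ _ [] = output≡[0]
relay-output {NC} {j} {N} initial one τ≤w (f ∷ fs) =
  cong₂ _∷_ (relay-fires {i = circuitInput (ln (process NC fs)) f} (evolve-relaying r fs))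
            (relay-output initial one τ≤w fs)
  where
  r : Relaying j (Lsize NC) N
  r = record { one-input = one ; fires-on-input = τ≤w ; resting = inj₂ (proj₂ initial) }

received-external : ∀ {NC m} → length (ln NC) ≤ m →
                    ∀ inp → received NC inp m ≡ map (λ f → f m) inp
received-external         _   []       = refl
received-external {NC} {m} n≤m (f ∷ fs) =
  cong₂ _∷_ (circuitInput-external (ln (process NC fs)) f n≤length)
            (received-external n≤m fs)
  where
  n≤length : length (ln (process NC fs)) ≤ m
  n≤length = subst (_≤ m) (sym (length-process NC fs)) n≤m

received-internal : ∀ {NC N} → Initial N → N ∈ ln NC →
                    ∀ inp → received NC inp (id N) ≡ tl (output NC N inp)
received-internal {NC} (output≡[0] , _) N∈ [] =
  sym (cong tl (trans (output-evolve {NC} N∈ []) output≡[0]))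
received-internal {NC} {N} initial N∈ (f ∷ fs) = begin
  circuitInput (ln (process NC fs)) f (id N) ∷ received NC fs (id N)
    ≡⟨ cong₂ _∷_ (circuitInput-internal (ln (process NC fs)) f id<length)
                 (received-internal initial N∈ fs) ⟩
  headB (output NC N fs) ∷ tl (output NC N fs)
    ≡⟨ cong (λ bs → headB bs ∷ tl bs) (output-evolve N∈ fs) ⟩
  headB (Output (evolve NC fs N)) ∷ tl (Output (evolve NC fs N))
    ≡⟨ headB∷tl _ (All.lookup (out-length (process NC fs)) (evolve-∈ N∈ fs)) ⟩
  Output (evolve NC fs N)
    ≡⟨ cong tl (sym (output-evolve N∈ (f ∷ fs))) ⟩
  tl (output NC N (f ∷ fs)) ∎
  where
  id<length : id N < length (ln (process NC fs))
  id<length = subst (id N <_) (sym (length-process NC fs)) (All.lookup (ids-bound NC) N∈)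

output-relay-neuron : ∀ {NC N₁ N₂} → Initial N₁ → Initial N₂ → N₁ ∈ ln NC → N₂ ∈ ln NC →
                      One-input N₁ (id N₂) (Lsize NC) → τ N₁ Q.≤ w N₁ (id N₂) →
                      ∀ inp → output NC N₁ inp ≡ tl (output NC N₂ inp) ++ false ∷ []
output-relay-neuron {NC} {N₁} {N₂} initial₁ initial₂ N₁∈ N₂∈ one τ≤w inp = begin
  output NC N₁ inp                       ≡⟨ output-evolve N₁∈ inp ⟩
  Output (evolve NC inp N₁)              ≡⟨ relay-output initial₁ one τ≤w inp ⟩
  received NC inp (id N₂) ++ false ∷ []  ≡⟨ cong (_++ false ∷ []) (received-internal initial₂ N₂∈ inp) ⟩
  tl (output NC N₂ inp) ++ false ∷ []    ∎

output-relay-source : ∀ {NC N m} → Initial N → N ∈ ln NC → length (ln NC) ≤ m →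
                      One-input N m (Lsize NC) → τ N Q.≤ w N m →
                      ∀ inp → output NC N inp ≡ map (λ f → f m) inp ++ false ∷ []
output-relay-source {NC} {N} {m} initial N∈ n≤m one τ≤w inp = begin
  output NC N inp                        ≡⟨ output-evolve N∈ inp ⟩
  Output (evolve NC inp N)               ≡⟨ relay-output initial one τ≤w inp ⟩
  received NC inp m ++ false ∷ []        ≡⟨ cong (_++ false ∷ []) (received-external n≤m inp) ⟩
  map (λ f → f m) inp ++ false ∷ []      ∎

corollary5p2 : (NC : Circuit) → InitialCircuit NC → (inp : List (ℕ → Bool)) →
    ((N₁ N₂ : Neuron) → N₁ ∈ ln NC → N₂ ∈ ln NC →
      One-input N₁ (id N₂) (Lsize NC) → τ N₁ Q.≤ w N₁ (id N₂) →
      output NC N₁ inp ≡ tl (output NC N₂ inp) ++ (false ∷ []))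
    × ((N : Neuron) (m : ℕ) → N ∈ ln NC → length (ln NC) ≤ m → m < Lsize NC →
      One-input N m (Lsize NC) → τ N Q.≤ w N m →
      output NC N inp ≡ map (λ f → f m) inp ++ (false ∷ []))
corollary5p2 NC initial inp =
    (λ N₁ N₂ N₁∈ N₂∈ one τ≤w →
       output-relay-neuron (All.lookup initial N₁∈) (All.lookup initial N₂∈) N₁∈ N₂∈ one τ≤w inp)
  -- the bound m < Lsize NC is already part of One-input
  , (λ N m N∈ n≤m _ one τ≤w →
       output-relay-source (All.lookup initial N∈) N∈ n≤m one τ≤w inp)
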